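{- Let $k\ge 2$ be an integer, let $T$ be a tree, let $r\in V(T)$, and assume that for every integer $l\ge 1$ there are at most $k^l$ vertices at distance exactly $l$ from $r$ in $T$. Let $\phi:V(T)\to\{0,1,2,\dots\}$ satisfy $\phi(r)=0$ and $\phi(t)\ne 0$ for at least one $t\in V(T)$. Then there exist an integer $l$ and a vertex $t\in V(T)$ at distance exactly $l$ from $r$ in $T$ such that $\phi(t)>0$ and $2l\log k+\log\phi(t)\ge\log\phi(T)$.
   Context: For a subgraph $H$ of $T$, $\phi(H):=\sum_{v\in V(H)}\phi(v)$; in particular $\phi(T)=\sum_{v\in V(T)}\phi(v)$. Logarithms are to a fixed base greater than $1$. -}

module Defs where

open import Data.Nat using (ℕ; zero; suc; _≤_)
open import Data.Fin using (Fin)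
open import Data.List using (List; []; _∷_; _++_; [_]; length; map; allFin)
open import Data.Nat.ListAction using (sum)
open import Data.Empty using (⊥)
open import Data.List.Relation.Unary.Linked using (Linked)
open import Data.List.Relation.Unary.Unique.Propositional using (Unique)
open import Data.Product using (Σ; ∃; _×_)
open import Relation.Nullary using (¬_)
open import Relation.Binary.PropositionalEquality using (_≡_)

record Graph (n : ℕ) : Set₁ where
  field
    Adj   : Fin n → Fin n → Set
    sym   : ∀ {u v} → Adj u v → Adj v u
    irrefl : ∀ {u} → ¬ Adj u u
open Graph public

data Walk {n : ℕ} (G : Graph n) : Fin n → Fin n → ℕ → Set where
  nil  : ∀ {u} → Walk G u u 0
  cons : ∀ {u w v l} → Adj G u w → Walk G w v l → Walk G u v (suc l)

Connected : {n : ℕ} → Graph n → Set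
Connected {n} G = (u v : Fin n) → ∃ λ l → Walk G u v l

IsCycle : {n : ℕ} → Graph n → List (Fin n) → Set
IsCycle G [] = ⊥
IsCycle G (x ∷ ys) = (2 ≤ length ys) × Unique (x ∷ ys) × Linked (Adj G) ((x ∷ ys) ++ [ x ])

Acyclic : {n : ℕ} → Graph n → Set
Acyclic {n} G = (c : List (Fin n)) → ¬ IsCycle G c

IsTree : {n : ℕ} → Graph n → Set
IsTree G = Connected G × Acyclic G

Dist : {n : ℕ} → Graph n → Fin n → Fin n → ℕ → Set
Dist G u v l = Walk G u v l × (∀ m → Walk G u v m → l ≤ m)

-- φ(T) = Σ_{v ∈ V(T)} φ(v)
total : {n : ℕ} → (Fin n → ℕ) → ℕ
total {n} φ = sum (map φ (allFin n))

module Submission where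

-- Write d(v) for the distance from r to v and let t maximise
-- Q(v) := k^(2 d(v)) · φ(v).  Since φ does not vanish everywhere, Q(t) > 0 and
-- hence φ(t) > 0.  For the inequality φ(T) ≤ Q(t), group the vertices by their
-- distance from r: the root contributes nothing (φ(r) = 0), and the at most k^l
-- vertices of level l ≥ 1 each carry weight at most Q(t)/k^(2l), so level l
-- carries at most Q(t)/k^l.  Summing the geometric series Σ_{l≥1} k^(-l) ≤ 1
-- (this is where k ≥ 2 is used) gives φ(T) ≤ Q(t).

open import Data.Nat using (ℕ; zero; suc; _+_; _*_; _^_; _≤_; _<_; _≟_; z≤n; s≤s; NonZero)
open import Data.Nat.Properties
  using ( ≤-refl; ≤-reflexive; ≤-trans; ≤-pred; m≤n⇒m≤1+n; <⇒≤; ≤∧≢⇒<; n≤0⇒n≡0; n≢0⇒n>0; n>0⇒n≢0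
        ; +-assoc; +-identityʳ; +-mono-≤; +-monoˡ-<; +-commutativeSemigroup
        ; *-comm; *-assoc; *-identityˡ; *-zeroʳ; *-suc; *-distribˡ-+; *-monoʳ-≤; *-monoˡ-≤; *-mono-<; *-cancelˡ-≤
        ; m^n≢0; m^n>0; ^-distribˡ-+-*; module ≤-Reasoning )
open import Data.Fin using (Fin)
import Data.Fin as Fin
open import Data.List using (List; []; _∷_; _++_; [_]; _ʳ++_; length; map; filter; allFin)
open import Data.Nat.ListAction using (sum)
open import Data.List.Extrema.Nat using (argmax; f[xs]≤f[argmax]; max; xs≤max)
open import Data.List.Relation.Unary.All as All using (All; []; _∷_)
open import Data.List.Relation.Unary.All.Properties as All using (¬Any⇒All¬; all-filter)
open import Data.List.Relation.Unary.Any using (here; there)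
open import Data.List.Relation.Unary.AllPairs using ([]; _∷_)
import Data.List.Relation.Unary.AllPairs as AllPairs
open import Data.List.Relation.Unary.Linked as Linked using (Linked; []; [-]; _∷_)
open import Data.List.Relation.Unary.Unique.Propositional using (Unique)
open import Data.List.Relation.Unary.Unique.Propositional.Properties as Unique using (Unique[x∷xs]⇒x∉xs; allFin⁺)
open import Data.List.Membership.Propositional using (_∈_; _∉_)
open import Data.List.Membership.Propositional.Properties using (∈-allFin)
open import Data.Product using (Σ; ∃; _×_; _,_; proj₁; proj₂)
open import Data.Unit using (⊤; tt)
open import Data.Empty using (⊥-elim)
open import Function using (_∘_)
open import Relation.Nullary using (yes; no)
open import Relation.Unary using (Pred; Decidable)
open import Relation.Unary.Properties using (∁?)
open import Relation.Binary using (Rel; Symmetric)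
open import Relation.Binary.PropositionalEquality using (_≡_; _≢_; refl; sym; trans; cong; cong₂; subst; ≢-sym; module ≡-Reasoning)
open import Algebra.Properties.CommutativeSemigroup +-commutativeSemigroup using (x∙yz≈y∙xz)
open import Data.Nat.Solver using (module +-*-Solver)
open +-*-Solver using (solve; _:+_; _:*_; _:=_; con)
open import Defs hiding (sym)

module ListFacts {A : Set} where

  -- A list is non-backtracking if no element equals the one two places later;
  -- read as the vertex sequence of a walk, no edge is immediately traversed back.
  NonBacktracking : List A → Set
  NonBacktracking (a ∷ b ∷ c ∷ xs) = a ≢ c × NonBacktracking (b ∷ c ∷ xs)
  NonBacktracking _ = ⊤

  nonBacktracking-tail : ∀ {a} xs → NonBacktracking (a ∷ xs) → NonBacktracking xs
  nonBacktracking-tail []          _        = tt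
  nonBacktracking-tail (b ∷ [])    _        = tt
  nonBacktracking-tail (b ∷ c ∷ xs) (_ , nb) = nb

  unique⇒nonBacktracking : ∀ {xs} → Unique xs → NonBacktracking xs
  unique⇒nonBacktracking {[]}             _                   = tt
  unique⇒nonBacktracking {a ∷ []}         _                   = tt
  unique⇒nonBacktracking {a ∷ b ∷ []}     _                   = tt
  unique⇒nonBacktracking {a ∷ b ∷ c ∷ xs} ((_ ∷ a≢c ∷ _) ∷ u) = a≢c , unique⇒nonBacktracking u

  HeadsDiffer : List A → List A → Set
  HeadsDiffer (a ∷ _) (b ∷ _) = a ≢ b
  HeadsDiffer _       _       = ⊤

  linked-glue : ∀ {ℓ} {R : Rel A ℓ} → Symmetric R → ∀ {a} xs {ys} →
                Linked R (a ∷ xs) → Linked R (a ∷ ys) → Linked R (xs ʳ++ a ∷ ys)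
  linked-glue R-sym []       _           lys = lys
  linked-glue R-sym (b ∷ xs) (Rab ∷ lxs) lys = linked-glue R-sym xs lxs (R-sym Rab ∷ lys)

  nonBacktracking-glue : ∀ a xs ys → NonBacktracking (a ∷ xs) → NonBacktracking (a ∷ ys) →
                         HeadsDiffer xs ys → NonBacktracking (xs ʳ++ a ∷ ys)
  nonBacktracking-glue a []       ys _    nbys _     = nbys
  nonBacktracking-glue a (b ∷ xs) ys nbxs nbys heads =
    nonBacktracking-glue b xs (a ∷ ys) (nonBacktracking-tail (b ∷ xs) nbxs) (turn ys nbys heads) (leave xs nbxs)
    where
    turn : ∀ ys → NonBacktracking (a ∷ ys) → HeadsDiffer (b ∷ xs) ys → NonBacktracking (b ∷ a ∷ ys)
    turn []       _  _   = tt
    turn (c ∷ ys) nb b≢c = b≢c , nb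
    leave : ∀ xs → NonBacktracking (a ∷ b ∷ xs) → HeadsDiffer xs (a ∷ ys)
    leave []       _         = tt
    leave (c ∷ xs) (a≢c , _) = ≢-sym a≢c

  ʳ++-unique-suffix : ∀ (xs : List A) {ys} → Unique (xs ʳ++ ys) → Unique ys
  ʳ++-unique-suffix []       u = u
  ʳ++-unique-suffix (x ∷ xs) u = AllPairs.tail (ʳ++-unique-suffix xs u)

  ʳ++-unique-disjoint : ∀ (xs : List A) {ys v} → Unique (xs ʳ++ ys) → v ∈ xs → v ∉ ys
  ʳ++-unique-disjoint (x ∷ xs) u (here refl)  = Unique[x∷xs]⇒x∉xs (ʳ++-unique-suffix xs u)
  ʳ++-unique-disjoint (x ∷ xs) u (there v∈xs) = ʳ++-unique-disjoint xs u v∈xs ∘ there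

  split-unique : ∀ {x ys} → Unique ys → x ∈ ys →
                 Σ (List A) λ pre → Σ (List A) λ post → ys ≡ pre ++ x ∷ post × Unique (x ∷ pre)
  split-unique u (here refl) = [] , _ , refl , [] ∷ []
  split-unique (y∉ys ∷ u) (there x∈ys) with split-unique u x∈ys
  ... | pre , post , refl , (x∉pre ∷ u-pre) =
    _ ∷ pre , post , refl , (≢-sym (All.lookup y∉ys x∈ys) ∷ x∉pre) ∷ (All.++⁻ˡ pre y∉ys ∷ u-pre)

  linked-prefix : ∀ {ℓ} {R : Rel A ℓ} xs {y ys} → Linked R (xs ++ y ∷ ys) → Linked R (xs ++ [ y ])
  linked-prefix []           _          = [-]
  linked-prefix (a ∷ [])     (Ray ∷ _)  = Ray ∷ [-]
  linked-prefix (a ∷ b ∷ xs) (Rab ∷ lk) = Rab ∷ linked-prefix (b ∷ xs) lk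

  sum-filter : ∀ (f : A → ℕ) {ℓ} {P : Pred A ℓ} (P? : Decidable P) xs →
               sum (map f xs) ≡ sum (map f (filter P? xs)) + sum (map f (filter (∁? P?) xs))
  sum-filter f P? []       = refl
  sum-filter f P? (x ∷ xs) with P? x
  ... | yes _ = trans (cong (f x +_) (sum-filter f P? xs)) (sym (+-assoc (f x) _ _))
  ... | no  _ = trans (cong (f x +_) (sum-filter f P? xs)) (x∙yz≈y∙xz (f x) (sum (map f (filter P? xs))) _)

open ListFacts

module TreeFacts {n : ℕ} (G : Graph n) where

  open import Data.List.Membership.DecPropositional (Fin._≟_ {n}) using (_∈?_)

  visited  : ∀ {u v l} → Walk G u v l → List (Fin n)
  vertices : ∀ {u v l} → Walk G u v l → List (Fin n)
  visited nil        = []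
  visited (cons _ w) = vertices w
  vertices {u} w = u ∷ visited w

  vertices-linked : ∀ {u v l} (w : Walk G u v l) → Linked (Adj G) (vertices w)
  vertices-linked nil                 = [-]
  vertices-linked (cons e nil)        = e ∷ [-]
  vertices-linked (cons e (cons f w)) = e ∷ vertices-linked (cons f w)

  end∈vertices : ∀ {u v l} (w : Walk G u v l) → v ∈ vertices w
  end∈vertices nil        = here refl
  end∈vertices (cons _ w) = there (end∈vertices w)

  IsPath : ∀ {u v l} → Walk G u v l → Set
  IsPath w = Unique (vertices w)

  Path : Fin n → Fin n → ℕ → Set
  Path u v l = Σ (Walk G u v l) IsPath

  -- In an acyclic graph a non-backtracking walk never revisits a vertex: the
  -- first revisit would close a cycle of length at least 3.
  nonBacktracking-unique : Acyclic G → ∀ xs → Linked (Adj G) xs → NonBacktracking xs → Unique xs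
  nonBacktracking-unique acyc []       _  _  = []
  nonBacktracking-unique acyc (x ∷ ys) lk nb
    with nonBacktracking-unique acyc ys (Linked.tail lk) (nonBacktracking-tail ys nb) | x ∈? ys
  ... | u-ys | no x∉ys = ¬Any⇒All¬ ys x∉ys ∷ u-ys
  ... | u-ys | yes x∈ys with split-unique u-ys x∈ys
  ...   | pre , post , refl , u-cycle =
    ⊥-elim (acyc (x ∷ pre) (long pre lk nb , u-cycle , linked-prefix (x ∷ pre) lk))
    where
    long : ∀ pre → Linked (Adj G) (x ∷ pre ++ x ∷ post) → NonBacktracking (x ∷ pre ++ x ∷ post) →
           2 ≤ length pre
    long []           (Axx ∷ _) _         = ⊥-elim (irrefl G Axx)
    long (a ∷ [])     _         (x≢x , _) = ⊥-elim (x≢x refl)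
    long (a ∷ b ∷ _)  _         _         = s≤s (s≤s z≤n)

  path-length-unique : Acyclic G → ∀ {x v a b} (P : Walk G x v a) (Q : Walk G x v b) →
                       IsPath P → IsPath Q → a ≡ b
  path-length-unique acyc nil        nil        _ _ = refl
  path-length-unique acyc nil        (cons _ Q) _ (x∉Q ∷ _) = ⊥-elim (All.lookup x∉Q (end∈vertices Q) refl)
  path-length-unique acyc (cons _ P) nil        (x∉P ∷ _) _ = ⊥-elim (All.lookup x∉P (end∈vertices P) refl)
  path-length-unique acyc {x} (cons {w = p} e P) (cons {w = q} f Q) uP uQ with p Fin.≟ q
  ... | yes refl = cong suc (path-length-unique acyc P Q (AllPairs.tail uP) (AllPairs.tail uQ))
  ... | no p≢q = ⊥-elim (ʳ++-unique-disjoint (vertices P) glued (end∈vertices P) (there (end∈vertices Q)))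
    where
    -- P reversed, then Q: a non-backtracking walk from v through x back to v.
    glued : Unique (vertices P ʳ++ x ∷ vertices Q)
    glued = nonBacktracking-unique acyc _
      (linked-glue (Graph.sym G) (vertices P) (vertices-linked (cons e P)) (vertices-linked (cons f Q)))
      (nonBacktracking-glue x (vertices P) (vertices Q)
         (unique⇒nonBacktracking uP) (unique⇒nonBacktracking uQ) p≢q)

  path-suffix : ∀ {x v l u} (p : Walk G x v l) → IsPath p → u ∈ vertices p →
                ∃ λ l′ → l′ ≤ l × Path u v l′
  path-suffix nil        up       (here refl) = 0 , z≤n , nil , up
  path-suffix (cons e p) up       (here refl) = _ , ≤-refl , cons e p , up
  path-suffix (cons e p) (_ ∷ up) (there u∈p) with path-suffix p up u∈p
  ... | l′ , l′≤l , q = l′ , m≤n⇒m≤1+n l′≤l , q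

  walk⇒path : ∀ {x v l} → Walk G x v l → ∃ λ l′ → l′ ≤ l × Path x v l′
  walk⇒path nil = 0 , z≤n , nil , [] ∷ []
  walk⇒path {x} (cons e w) with walk⇒path w
  ... | l′ , l′≤l , p , up with x ∈? vertices p
  ...   | yes x∈p = let l″ , l″≤l′ , q = path-suffix p up x∈p in l″ , m≤n⇒m≤1+n (≤-trans l″≤l′ l′≤l) , q
  ...   | no x∉p  = suc l′ , s≤s l′≤l , cons e p , ¬Any⇒All¬ _ x∉p ∷ up

  walk-length-0 : ∀ {u v} → Walk G u v 0 → u ≡ v
  walk-length-0 nil = refl

  tree-distance : IsTree G → ∀ r v → ∃ λ d → Dist G r v d
  tree-distance (connected , acyc) r v with walk⇒path (proj₂ (connected r v))
  ... | d , _ , p , up = d , p , shortest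
    where
    shortest : ∀ m → Walk G r v m → d ≤ m
    shortest m w with walk⇒path w
    ... | m′ , m′≤m , q , uq = subst (_≤ m) (sym (path-length-unique acyc p q up uq)) m′≤m

2≤⇒nonZero : ∀ {k} → 2 ≤ k → NonZero k
2≤⇒nonZero (s≤s _) = _

module Counting {A : Set} (k : ℕ) (2≤k : 2 ≤ k) (depth φ : A → ℕ) (Q : ℕ)
  (level-size : ∀ l → 1 ≤ l → (vs : List A) → Unique vs → All (λ v → depth v ≡ l) vs → length vs ≤ k ^ l)
  (weight≤Q : ∀ v → k ^ (2 * depth v) * φ v ≤ Q)
  (root-weightless : ∀ v → depth v ≡ 0 → φ v ≡ 0) where

  instance
    k≢0 : NonZero k
    k≢0 = 2≤⇒nonZero 2≤k

  weight : List A → ℕ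
  weight vs = sum (map φ vs)

  geom : ℕ → ℕ
  geom zero    = 0
  geom (suc B) = 1 + k * geom B

  geom<pow : ∀ B → geom B < k ^ B
  geom<pow zero    = s≤s z≤n
  geom<pow (suc B) = begin-strict
    1 + k * geom B  <⟨ +-monoˡ-< (k * geom B) 2≤k ⟩
    k + k * geom B  ≡⟨ *-suc k (geom B) ⟨
    k * suc (geom B) ≤⟨ *-monoʳ-≤ k (geom<pow B) ⟩
    k * k ^ B       ∎
    where open ≤-Reasoning

  level-weight : ∀ l vs → All (λ v → depth v ≡ l) vs → k ^ (2 * l) * weight vs ≤ length vs * Q
  level-weight l []       _             = ≤-reflexive (*-zeroʳ (k ^ (2 * l)))
  level-weight l (v ∷ vs) (refl ∷ at-l) = begin
    k ^ (2 * l) * (φ v + weight vs)               ≡⟨ *-distribˡ-+ (k ^ (2 * l)) (φ v) _ ⟩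
    k ^ (2 * l) * φ v + k ^ (2 * l) * weight vs  ≤⟨ +-mono-≤ (weight≤Q v) (level-weight l vs at-l) ⟩
    Q + length vs * Q                            ∎
    where open ≤-Reasoning

  level-bound : ∀ l → 1 ≤ l → ∀ vs → Unique vs → All (λ v → depth v ≡ l) vs → k ^ l * weight vs ≤ Q
  level-bound l 1≤l vs u at-l = *-cancelˡ-≤ (k ^ l) {{m^n≢0 k l}} (begin
    k ^ l * (k ^ l * weight vs)  ≡⟨ *-assoc (k ^ l) (k ^ l) _ ⟨
    k ^ l * k ^ l * weight vs    ≡⟨ cong (_* weight vs) square ⟨
    k ^ (2 * l) * weight vs      ≤⟨ level-weight l vs at-l ⟩
    length vs * Q                ≤⟨ *-monoˡ-≤ Q (level-size l 1≤l vs u at-l) ⟩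
    k ^ l * Q                    ∎)
    where
    open ≤-Reasoning
    square : k ^ (2 * l) ≡ k ^ l * k ^ l
    square = trans (cong (λ e → k ^ (l + e)) (+-identityʳ l)) (^-distribˡ-+-* k l l)

  roots-weightless : ∀ vs → All (λ v → depth v ≤ 0) vs → weight vs ≡ 0
  roots-weightless []       _            = refl
  roots-weightless (v ∷ vs) (d≤0 ∷ d≤0s) =
    cong₂ _+_ (root-weightless v (n≤0⇒n≡0 d≤0)) (roots-weightless vs d≤0s)

  layers-bound : ∀ B vs → Unique vs → All (λ v → depth v ≤ B) vs → k ^ B * weight vs ≤ Q * geom B
  layers-bound zero vs _ shallow = ≤-reflexive (begin
    1 * weight vs  ≡⟨ *-identityˡ (weight vs) ⟩
    weight vs      ≡⟨ roots-weightless vs shallow ⟩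
    0              ≡⟨ *-zeroʳ Q ⟨
    Q * 0          ∎)
    where open ≡-Reasoning
  layers-bound (suc B) vs u shallow = begin
    k ^ suc B * weight vs                          ≡⟨ cong (k ^ suc B *_) (sum-filter φ deepest? vs) ⟩
    k ^ suc B * (weight ys + weight zs)            ≡⟨ *-distribˡ-+ (k ^ suc B) (weight ys) _ ⟩
    k ^ suc B * weight ys + k * k ^ B * weight zs  ≡⟨ cong (k ^ suc B * weight ys +_) (*-assoc k (k ^ B) _) ⟩
    k ^ suc B * weight ys + k * (k ^ B * weight zs)
      ≤⟨ +-mono-≤ (level-bound (suc B) (s≤s z≤n) ys (Unique.filter⁺ deepest? u) (all-filter deepest? vs))
                  (*-monoʳ-≤ k (layers-bound B zs (Unique.filter⁺ (∁? deepest?) u) zs-shallow)) ⟩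
    Q + k * (Q * geom B)                           ≡⟨ solve 3 (λ q k g → q :+ k :* (q :* g) := q :* (con 1 :+ k :* g)) refl Q k (geom B) ⟩
    Q * geom (suc B)                               ∎
    where
    open ≤-Reasoning
    deepest? : Decidable (λ v → depth v ≡ suc B)
    deepest? v = depth v ≟ suc B
    ys = filter deepest? vs
    zs = filter (∁? deepest?) vs
    zs-shallow : All (λ v → depth v ≤ B) zs
    zs-shallow = All.zipWith (λ (d≤1+B , d≢1+B) → ≤-pred (≤∧≢⇒< d≤1+B d≢1+B))
                             (All.filter⁺ (∁? deepest?) shallow , all-filter (∁? deepest?) vs)

  total-bound : ∀ vs → Unique vs → weight vs ≤ Q
  total-bound vs u = *-cancelˡ-≤ (k ^ B) {{m^n≢0 k B}} (begin
    k ^ B * weight vs  ≤⟨ layers-bound B vs u (All.map⁻ (xs≤max 0 (map depth vs))) ⟩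
    Q * geom B         ≤⟨ *-monoʳ-≤ Q (<⇒≤ (geom<pow B)) ⟩
    Q * k ^ B          ≡⟨ *-comm Q (k ^ B) ⟩
    k ^ B * Q          ∎)
    where
    open ≤-Reasoning
    B = max 0 (map depth vs)

lemma3p10 : (k : ℕ) → 2 ≤ k → (n : ℕ) → (T : Graph n) → IsTree T → (r : Fin n)
    → (∀ (l : ℕ) → 1 ≤ l → (vs : List (Fin n)) → Unique vs → All (λ v → Dist T r v l) vs → length vs ≤ k ^ l)
    → (φ : Fin n → ℕ) → φ r ≡ 0 → ∃ (λ t → φ t ≢ 0)
    → ∃ λ l → ∃ λ t → Dist T r t l × 0 < φ t × total φ ≤ k ^ (2 * l) * φ t
lemma3p10 k 2≤k n T tree r level-size φ φr≡0 (t₀ , φt₀≢0) =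
  depth t , t , proj₂ (distance t) , φt>0 , total≤Qt
  where
  open TreeFacts T
  distance : ∀ v → ∃ λ d → Dist T r v d
  distance = tree-distance tree r
  depth : Fin n → ℕ
  depth v = proj₁ (distance v)
  Q : Fin n → ℕ
  Q v = k ^ (2 * depth v) * φ v
  t : Fin n
  t = argmax Q r (allFin n)
  Qv≤Qt : ∀ v → Q v ≤ Q t
  Qv≤Qt v = All.lookup (f[xs]≤f[argmax] r (allFin n)) (∈-allFin v)
  -- Q(t) ≥ Q(t₀) > 0 forces φ(t) > 0.
  φt>0 : 0 < φ t
  φt>0 = n≢0⇒n>0 λ φt≡0 → n>0⇒n≢0 Qt>0 (Qt≡0 φt≡0)
    where
    Qt>0 : 0 < Q t
    Qt>0 = ≤-trans (*-mono-< (m^n>0 k {{2≤⇒nonZero 2≤k}} (2 * depth t₀)) (n≢0⇒n>0 φt₀≢0)) (Qv≤Qt t₀)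
    Qt≡0 : φ t ≡ 0 → Q t ≡ 0
    Qt≡0 φt≡0 = trans (cong (k ^ (2 * depth t) *_) φt≡0) (*-zeroʳ (k ^ (2 * depth t)))
  total≤Qt : total φ ≤ Q t
  total≤Qt = Counting.total-bound k 2≤k depth φ (Q t) depth-level-size Qv≤Qt root-weightless (allFin n) (allFin⁺ n)
    where
    depth-level-size : ∀ l → 1 ≤ l → (vs : List (Fin n)) → Unique vs → All (λ v → depth v ≡ l) vs → length vs ≤ k ^ l
    depth-level-size l 1≤l vs u at-l = level-size l 1≤l vs u (All.map (λ { {v} refl → proj₂ (distance v) }) at-l)
    root-weightless : ∀ v → depth v ≡ 0 → φ v ≡ 0
    root-weightless v depth≡0 = subst (λ u → φ u ≡ 0) r≡v φr≡0
      where
      r≡v : r ≡ v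
      r≡v = walk-length-0 (subst (Walk T r v) depth≡0 (proj₁ (proj₂ (distance v))))
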